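{- Let $Q$ and $\eta$ be as in the context, and let $T$ be a triangulation of $Q$. The descent set of $T$ is described as follows; for $a\in[n-1]$: (i) if $a$ and $a+1$ are both down indices, $(a,a+1)$ is a descent of $T$ iff there is a diagonal $a$—$i$ in $T$ with $i>a+1$, iff there is no diagonal $i$—$(a+1)$ in $T$ with $i<a$; (ii) if $a$ is down and $a+1$ is up, $(a,a+1)$ is a descent iff $a$—$(a+1)$ is a diagonal in $T$; (iii) if $a$ and $a+1$ are both up, $(a,a+1)$ is a descent iff there is no diagonal $a$—$i$ in $T$ with $i>a+1$, iff there is a diagonal $i$—$(a+1)$ in $T$ with $i<a$; (iv) if $a$ is up and $a+1$ is down, $(a,a+1)$ is a descent iff $a$—$(a+1)$ is not a diagonal in $T$.
   Context: Let $Q\subset\mathbb R^2$ be a convex polygon with vertices $v_0,\dots,v_{n+1}$ whose $x$-coordinates strictly increase with the index, $v_0,v_{n+1}$ on the $x$-axis, and each $v_i$ ($i\in[n]$) strictly above (up index) or strictly below (down index) the $x$-axis. For $x=x_1\cdots x_n\in S_n$: $H_0$ is the set of down indices, $H_i=H_{i-1}\setminus\{x_i\}$ if $x_i$ is down and $H_{i-1}\cup\{x_i\}$ if up; $\lambda_i(x)$ is the polygonal path from $v_0$ through $v_j$, $j\in H_i$, in increasing order, to $v_{n+1}$; $\eta(x)$ is the triangulation whose diagonals are the non-edge segments of $\lambda_0(x),\dots,\lambda_n(x)$. The diagonal $v_iv_j$ is written $i$—$j$. The left descent set of a permutation $x$ is the set of transpositions $(a,a+1)$ such that $a+1$ appears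 to the left of $a$ in the one-line notation of $x$. The descent set of a triangulation $T$ (in the image of $\eta$) is the left descent set of any $x\in S_n$ with $\eta(x)=T$; this is independent of the choice of $x$. -}

module Defs where

open import Data.Nat using (ℕ; zero; suc; _+_; _<_; _≤_; _≡ᵇ_)
open import Data.Nat.Properties using (_<?_)
open import Data.Fin using (Fin; fromℕ<; toℕ)
open import Data.Bool using (Bool; true; false; not; if_then_else_)
open import Data.List using (List; upTo; map; take; foldl; length; lookup)
open import Data.Product using (Σ; _×_; ∃-syntax)
open import Data.Sum using (_⊎_)
open import Relation.Nullary using (¬_; yes; no)
open import Relation.Binary.PropositionalEquality using (_≡_)

-- The polygon Q is encoded combinatorially by n and the up/down signs of the
-- vertices v_1 … v_n:  σ k = true  iff  v_(k+1) is above the x-axis (up).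
-- Vertex v_i is encoded by the natural number i (0 ≤ i ≤ n+1).

isUp : ∀ {n} → (Fin n → Bool) → ℕ → Bool
isUp σ zero = false
isUp {n} σ (suc i) with i <? n
... | yes p = σ (fromℕ< p)
... | no _ = false

isDown : ∀ {n} → (Fin n → Bool) → ℕ → Bool
isDown σ zero = false
isDown {n} σ (suc i) with i <? n
... | yes p = not (σ (fromℕ< p))
... | no _ = false

Up : ∀ {n} → (Fin n → Bool) → ℕ → Set
Up σ i = isUp σ i ≡ true

Down : ∀ {n} → (Fin n → Bool) → ℕ → Set
Down σ i = isDown σ i ≡ true

-- Since the x-coordinates increase with the index
-- and Q is convex, the boundary of Q is the upper chain v_0, (up vertices in
-- increasing order), v_(n+1) together with the lower chain v_0, (down vertices
-- in increasing order), v_(n+1).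
IsEdge : ∀ {n} → (Fin n → Bool) → ℕ → ℕ → Set
IsEdge {n} σ i j =
  ((i ≡ 0 ⊎ Up σ i) × (j ≡ suc n ⊎ Up σ j) × (∀ m → i < m → m < j → ¬ Up σ m))
  ⊎ ((i ≡ 0 ⊎ Down σ i) × (j ≡ suc n ⊎ Down σ j) × (∀ m → i < m → m < j → ¬ Down σ m))

-- [n] = 1, 2, …, n ; a permutation x ∈ S_n is a list x = x_1 ⋯ x_n (one-line
-- notation) which is a rearrangement of [n].
range : ℕ → List ℕ
range n = map suc (upTo n)

-- One step of the recursion for H:  H_i = H_(i-1) \ {x_i} if x_i is down,
-- H_i = H_(i-1) ∪ {x_i} if x_i is up.
stepH : ∀ {n} → (Fin n → Bool) → (ℕ → Bool) → ℕ → (ℕ → Bool)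
stepH σ h y i = if i ≡ᵇ y then isUp σ y else h i

-- H σ x k : characteristic function of H_k  (H_0 = set of down indices).
H : ∀ {n} → (Fin n → Bool) → List ℕ → ℕ → (ℕ → Bool)
H σ x k = foldl (stepH σ) (isDown σ) (take k x)

OnPath : ∀ {n} → (Fin n → Bool) → List ℕ → ℕ → ℕ → Set
OnPath {n} σ x k i = i ≡ 0 ⊎ i ≡ suc n ⊎ H σ x k i ≡ true

IsSegment : ∀ {n} → (Fin n → Bool) → List ℕ → ℕ → ℕ → ℕ → Set
IsSegment σ x k i j =
  i < j × OnPath σ x k i × OnPath σ x k j × (∀ m → i < m → m < j → H σ x k m ≡ false)

η : ∀ {n} → (Fin n → Bool) → List ℕ → ℕ → ℕ → Set
η {n} σ x i j = i < j × (∃[ k ] (k ≤ n × IsSegment σ x k i j)) × ¬ IsEdge σ i j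

LeftDescent : List ℕ → ℕ → Set
LeftDescent x a = Σ (Fin (length x)) λ p → Σ (Fin (length x)) λ q →
  toℕ p < toℕ q × lookup x p ≡ suc a × lookup x q ≡ a

{-# OPTIONS --safe #-}
-- Once the first k letters of x have been read, an index y ∈ [n] lies in H_k
-- exactly when it is up and already read, or down and not yet read. A diagonal
-- of η(x) ending at a or a+1 is a segment of some path λ_k, and which of a and
-- a+1 that path visits is decided by this rule. Each diagonal condition thus
-- says that some prefix of x contains one of a, a+1 but not the other, that is,
-- that one of them precedes the other in x.
module Submission where

open import Defs
open import Data.Nat using (ℕ; zero; suc; _<_; _≤_; z≤n; s≤s)
open import Data.Nat.Properties
  using (_≟_; _<?_; ≤-refl; ≤-reflexive; ≤-trans; ≤-pred; <⇒≤; <⇒≢; <⇒≱; ≤∧≢⇒<;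
         1+n≰n; 1+n≢n; m<n⇒m<1+n; m≤n⇒m≤1+n; m≤n⇒m<n∨m≡n; suc-injective)
open import Data.Fin using (Fin; toℕ; fromℕ<) renaming (zero to fzero; suc to fsuc)
open import Data.Bool using (Bool; true; false; if_then_else_)
open import Data.List using (List; []; _∷_; upTo; take; foldl; length; lookup)
open import Data.List.Relation.Unary.Any using (here; there; index)
open import Data.List.Relation.Unary.Any.Properties using (lookup-index)
open import Data.List.Relation.Unary.All.Properties using (All¬⇒¬Any)
open import Data.List.Relation.Unary.AllPairs using (_∷_)
open import Data.List.Relation.Unary.Unique.Propositional using (Unique)
import Data.List.Relation.Unary.Unique.Propositional.Properties as Unique
open import Data.List.Membership.Propositional using (_∈_; _∉_)
open import Data.List.Membership.Propositional.Properties using (∈-lookup; ∈-map⁺; ∈-upTo⁺)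
open import Data.List.Membership.DecPropositional _≟_ using (_∈?_)
open import Data.List.Relation.Binary.Permutation.Propositional using (_↭_; ↭-sym; ↭⇒↭ₛ)
open import Data.List.Relation.Binary.Permutation.Propositional.Properties using (∈-resp-↭; ↭-length)
open import Data.List.Relation.Binary.Permutation.Setoid.Properties using (Unique-resp-↭)
open import Data.List.Properties using (length-map; length-upTo)
open import Data.Product using (Σ; _×_; _,_; ∃-syntax; proj₁; map₂)
open import Data.Product.Function.NonDependent.Propositional using (_×-⇔_)
open import Data.Sum using (_⊎_; inj₁; inj₂; [_,_]′)
import Data.Sum as Sum
open import Function using (_∘_; const)
open import Function.Bundles using (_⇔_; mk⇔; Equivalence)
open import Function.Construct.Composition using (_⇔-∘_)
open import Function.Construct.Symmetry using (⇔-sym)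
open import Function.Properties.Inverse using (↔⇒⇔)
open import Function.Related.TypeIsomorphisms using (¬-cong-⇔; ×-comm)
open import Relation.Nullary using (¬_; yes; no; contradiction)
open import Relation.Nullary.Decidable using (dec-true; dec-false)
open import Relation.Binary.PropositionalEquality
  using (_≡_; _≢_; refl; sym; trans; cong; setoid)

private variable
  A : Set
  u v z : A
  xs : List A
  P Q : ℕ → Set
  a i j m n y : ℕ

Precedes : List A → A → A → Set
Precedes xs u v = Σ (Fin (length xs)) λ p → Σ (Fin (length xs)) λ q →
  toℕ p < toℕ q × lookup xs p ≡ u × lookup xs q ≡ v

precedes-∷ : Precedes xs u v → Precedes (z ∷ xs) u v
precedes-∷ (p , q , p<q , refl , refl) = fsuc p , fsuc q , s≤s p<q , refl , refl

head-precedes : v ∈ xs → Precedes (u ∷ xs) u v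
head-precedes v∈xs = fzero , fsuc (index v∈xs) , s≤s z≤n , refl , sym (lookup-index v∈xs)

precedes-∷⁻ : Precedes (z ∷ xs) u v → (u ≡ z × v ∈ xs) ⊎ Precedes xs u v
precedes-∷⁻ (fzero , fsuc q , _ , refl , refl) = inj₁ (refl , ∈-lookup q)
precedes-∷⁻ (fsuc p , fsuc q , s≤s p<q , refl , refl) = inj₂ (p , q , p<q , refl , refl)

precedes⇒∈ʳ : Precedes xs u v → v ∈ xs
precedes⇒∈ʳ (_ , q , _ , _ , refl) = ∈-lookup q

precedes-total : u ≢ v → u ∈ xs → v ∈ xs → Precedes xs u v ⊎ Precedes xs v u
precedes-total u≢v (here refl) (here refl) = contradiction refl u≢v
precedes-total _ (here refl) (there v∈xs) = inj₁ (head-precedes v∈xs)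
precedes-total _ (there u∈xs) (here refl) = inj₂ (head-precedes u∈xs)
precedes-total u≢v (there u∈xs) (there v∈xs) =
  Sum.map precedes-∷ precedes-∷ (precedes-total u≢v u∈xs v∈xs)

precedes-asym : Unique xs → Precedes xs u v → ¬ Precedes xs v u
precedes-asym {xs = z ∷ xs} (z∉xs ∷ unique) uv vu with precedes-∷⁻ uv | precedes-∷⁻ vu
... | inj₁ (refl , _)   | inj₁ (refl , z∈xs) = All¬⇒¬Any z∉xs z∈xs
... | inj₁ (refl , _)   | inj₂ vu′           = All¬⇒¬Any z∉xs (precedes⇒∈ʳ vu′)
... | inj₂ uv′          | inj₁ (refl , _)    = All¬⇒¬Any z∉xs (precedes⇒∈ʳ uv′)
... | inj₂ uv′          | inj₂ vu′           = precedes-asym unique uv′ vu′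

precedes⇔¬precedes : Unique xs → u ≢ v → u ∈ xs → v ∈ xs →
  Precedes xs u v ⇔ (¬ Precedes xs v u)
precedes⇔¬precedes unique u≢v u∈xs v∈xs = mk⇔
  (precedes-asym unique)
  (λ ¬vu → [ (λ uv → uv) , (λ vu → contradiction vu ¬vu) ]′ (precedes-total u≢v u∈xs v∈xs))

precedes⇒prefix : Unique xs → Precedes xs u v →
  ∃[ k ] (k ≤ length xs × u ∈ take k xs × v ∉ take k xs)
precedes⇒prefix {xs = z ∷ xs} (z∉xs ∷ unique) uv with precedes-∷⁻ uv
... | inj₁ (refl , v∈xs) = 1 , s≤s z≤n , here refl , λ { (here refl) → All¬⇒¬Any z∉xs v∈xs }
... | inj₂ uv′ with precedes⇒prefix unique uv′
...   | k , k≤ , u∈ , v∉ = suc k , s≤s k≤ , there u∈ , λ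
  { (here refl) → All¬⇒¬Any z∉xs (precedes⇒∈ʳ uv′)
  ; (there v∈) → v∉ v∈ }

prefix⇒precedes : ∀ {k} → v ∈ xs → u ∈ take k xs → v ∉ take k xs → Precedes xs u v
prefix⇒precedes {k = suc k} (here refl) _ v∉ = contradiction (here refl) v∉
prefix⇒precedes {k = suc k} (there v∈xs) (here refl) _ = head-precedes v∈xs
prefix⇒precedes {k = suc k} (there v∈xs) (there u∈) v∉ =
  precedes-∷ (prefix⇒precedes v∈xs u∈ (v∉ ∘ there))

precedes⇔prefix : Unique xs → v ∈ xs → length xs ≤ n →
  Precedes xs u v ⇔ (∃[ k ] (k ≤ n × u ∈ take k xs × v ∉ take k xs))
precedes⇔prefix unique v∈xs length≤n = mk⇔
  (λ uv → let (k , k≤ , u∈ , v∉) = precedes⇒prefix unique uv in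
           k , ≤-trans k≤ length≤n , u∈ , v∉)
  (λ (_ , _ , u∈ , v∉) → prefix⇒precedes v∈xs u∈ v∉)

∃≤-cong : (∀ {k} → P k ⇔ Q k) → (∃[ k ] (k ≤ n × P k)) ⇔ (∃[ k ] (k ≤ n × Q k))
∃≤-cong P⇔Q = mk⇔ (map₂ (map₂ (Equivalence.to P⇔Q))) (map₂ (map₂ (Equivalence.from P⇔Q)))

↭range⇒unique : xs ↭ range n → Unique xs
↭range⇒unique {n = n} xs↭ =
  Unique-resp-↭ (setoid ℕ) (↭⇒↭ₛ (↭-sym xs↭)) (Unique.map⁺ suc-injective (Unique.upTo⁺ n))

↭range⇒length : xs ↭ range n → length xs ≡ n
↭range⇒length {n = n} xs↭ = trans (↭-length xs↭) (trans (length-map suc (upTo n)) (length-upTo n))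

∈-↭range : xs ↭ range n → 1 ≤ y → y ≤ n → y ∈ xs
∈-↭range {y = suc y} xs↭ _ y<n = ∈-resp-↭ (↭-sym xs↭) (∈-map⁺ suc (∈-upTo⁺ y<n))

nearestAbove : (g : ℕ → Bool) → a < j →
  ∃[ i ] (a < i × (i ≡ j ⊎ g i ≡ true) × (∀ m → a < m → m < i → g m ≡ false))
nearestAbove {a} {suc j} g a<1+j with m≤n⇒m<n∨m≡n (≤-pred a<1+j)
... | inj₂ refl =
  suc a , ≤-refl , inj₁ refl , λ m a<m m<1+a → contradiction (≤-pred m<1+a) (<⇒≱ a<m)
... | inj₁ a<j with nearestAbove g a<j
...   | i , a<i , inj₂ gi , gap = i , a<i , inj₂ gi , gap
...   | i , a<i , inj₁ refl , gap with g i in gi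
...     | true = i , a<i , inj₂ gi , gap
...     | false = suc i , a<1+j , inj₁ refl , gap′
  where
  gap′ : ∀ m → a < m → m < suc i → g m ≡ false
  gap′ m a<m m<1+i with m≤n⇒m<n∨m≡n (≤-pred m<1+i)
  ... | inj₁ m<i = gap m a<m m<i
  ... | inj₂ refl = gi

nearestBelow : (g : ℕ → Bool) (j : ℕ) →
  ∃[ i ] (i ≤ j × (i ≡ 0 ⊎ g i ≡ true) × (∀ m → i < m → m ≤ j → g m ≡ false))
nearestBelow g zero = 0 , z≤n , inj₁ refl , λ m 0<m m≤0 → contradiction m≤0 (<⇒≱ 0<m)
nearestBelow g (suc j) with g (suc j) in gj
... | true = suc j , ≤-refl , inj₂ gj , λ m j<m m≤j → contradiction m≤j (<⇒≱ j<m)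
... | false with nearestBelow g j
...   | i , i≤j , end , gap = i , m≤n⇒m≤1+n i≤j , end , gap′
  where
  gap′ : ∀ m → i < m → m ≤ suc j → g m ≡ false
  gap′ m i<m m≤1+j with m≤n⇒m<n∨m≡n m≤1+j
  ... | inj₁ m<1+j = gap m i<m (≤-pred m<1+j)
  ... | inj₂ refl = gj

module _ (σ : Fin n → Bool) where

  up⇒isDown≡false : ∀ y → Up σ y → isDown σ y ≡ false
  up⇒isDown≡false zero ()
  up⇒isDown≡false (suc y) up with y <? n
  ... | no _ = refl
  ... | yes y<n with σ (fromℕ< y<n)
  ...   | true = refl
  ...   | false = contradiction up λ ()

  down⇒isUp≡false : ∀ y → Down σ y → isUp σ y ≡ false
  down⇒isUp≡false zero ()
  down⇒isUp≡false (suc y) down with y <? n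
  ... | no _ = refl
  ... | yes y<n with σ (fromℕ< y<n)
  ...   | true = contradiction down λ ()
  ...   | false = refl

  up⇒¬down : ∀ y → Up σ y → ¬ Down σ y
  up⇒¬down y up down = contradiction (trans (sym down) (up⇒isDown≡false y up)) λ ()

  up⇒≤n : ∀ y → Up σ y → y ≤ n
  up⇒≤n zero ()
  up⇒≤n (suc y) up with y <? n
  ... | yes y<n = y<n
  ... | no _ = contradiction up λ ()

  down⇒≤n : ∀ y → Down σ y → y ≤ n
  down⇒≤n zero ()
  down⇒≤n (suc y) down with y <? n
  ... | yes y<n = y<n
  ... | no _ = contradiction down λ ()

  -- does (y ≟ z) computes to y ≡ᵇ z, the test made by stepH.
  stepH-self : ∀ h y → stepH σ h y y ≡ isUp σ y
  stepH-self h y = cong (λ b → if b then isUp σ y else h y) (dec-true (y ≟ y) refl)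

  stepH-other : ∀ h → y ≢ z → stepH σ h z y ≡ h y
  stepH-other {y} {z} h y≢z = cong (λ b → if b then isUp σ z else h y) (dec-false (y ≟ z) y≢z)

  foldl-stepH-∉ : ∀ {h l} → y ∉ l → foldl (stepH σ) h l y ≡ h y
  foldl-stepH-∉ {l = []} _ = refl
  foldl-stepH-∉ {h = h} {z ∷ l} y∉ = trans (foldl-stepH-∉ (y∉ ∘ there)) (stepH-other h (y∉ ∘ here))

  foldl-stepH-∈ : ∀ {h l} → y ∈ l → foldl (stepH σ) h l y ≡ isUp σ y
  foldl-stepH-∈ {l = _ ∷ _} (there y∈) = foldl-stepH-∈ y∈
  foldl-stepH-∈ {y} {h} {_ ∷ l} (here refl) with y ∈? l
  ... | yes y∈ = foldl-stepH-∈ y∈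
  ... | no y∉ = trans (foldl-stepH-∉ y∉) (stepH-self h y)

  module _ {x : List ℕ} {k : ℕ} where

    up⇒H≡true⇔∈ : ∀ y → Up σ y → (H σ x k y ≡ true) ⇔ (y ∈ take k x)
    up⇒H≡true⇔∈ y up with y ∈? take k x
    ... | yes y∈ = mk⇔ (const y∈) (const (trans (foldl-stepH-∈ y∈) up))
    ... | no y∉ = mk⇔
      (λ h → contradiction (trans (sym h) (trans (foldl-stepH-∉ y∉) (up⇒isDown≡false y up))) λ ())
      (λ y∈ → contradiction y∈ y∉)

    up⇒H≡false⇔∉ : ∀ y → Up σ y → (H σ x k y ≡ false) ⇔ (y ∉ take k x)
    up⇒H≡false⇔∉ y up with y ∈? take k x
    ... | yes y∈ = mk⇔
      (λ h → contradiction (trans (sym h) (trans (foldl-stepH-∈ y∈) up)) λ ())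
      (λ y∉ → contradiction y∈ y∉)
    ... | no y∉ = mk⇔ (const y∉) (const (trans (foldl-stepH-∉ y∉) (up⇒isDown≡false y up)))

    down⇒H≡true⇔∉ : ∀ y → Down σ y → (H σ x k y ≡ true) ⇔ (y ∉ take k x)
    down⇒H≡true⇔∉ y down with y ∈? take k x
    ... | yes y∈ = mk⇔
      (λ h → contradiction (trans (sym h) (trans (foldl-stepH-∈ y∈) (down⇒isUp≡false y down))) λ ())
      (λ y∉ → contradiction y∈ y∉)
    ... | no y∉ = mk⇔ (const y∉) (const (trans (foldl-stepH-∉ y∉) down))

    down⇒H≡false⇔∈ : ∀ y → Down σ y → (H σ x k y ≡ false) ⇔ (y ∈ take k x)
    down⇒H≡false⇔∈ y down with y ∈? take k x
    ... | yes y∈ = mk⇔ (const y∈) (const (trans (foldl-stepH-∈ y∈) (down⇒isUp≡false y down)))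
    ... | no y∉ = mk⇔
      (λ h → contradiction (trans (sym h) (trans (foldl-stepH-∉ y∉) down)) λ ())
      (λ y∈ → contradiction y∈ y∉)

  ¬IsEdge-over-up : Up σ i ⊎ Up σ j → Up σ m → i < m → m < j → ¬ IsEdge σ i j
  ¬IsEdge-over-up _ up-m i<m m<j (inj₁ (_ , _ , gap)) = gap _ i<m m<j up-m
  ¬IsEdge-over-up (inj₁ ()) _ _ _ (inj₂ (inj₁ refl , _))
  ¬IsEdge-over-up {i} (inj₁ up-i) _ _ _ (inj₂ (inj₂ down-i , _)) = up⇒¬down i up-i down-i
  ¬IsEdge-over-up (inj₂ up-j) _ _ _ (inj₂ (_ , inj₁ refl , _)) = 1+n≰n (up⇒≤n (suc n) up-j)
  ¬IsEdge-over-up {j = j} (inj₂ up-j) _ _ _ (inj₂ (_ , inj₂ down-j , _)) = up⇒¬down j up-j down-j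

  ¬IsEdge-over-down : Down σ i ⊎ Down σ j → Down σ m → i < m → m < j → ¬ IsEdge σ i j
  ¬IsEdge-over-down _ down-m i<m m<j (inj₂ (_ , _ , gap)) = gap _ i<m m<j down-m
  ¬IsEdge-over-down (inj₁ ()) _ _ _ (inj₁ (inj₁ refl , _))
  ¬IsEdge-over-down {i} (inj₁ down-i) _ _ _ (inj₁ (inj₂ up-i , _)) = up⇒¬down i up-i down-i
  ¬IsEdge-over-down (inj₂ down-j) _ _ _ (inj₁ (_ , inj₁ refl , _)) = 1+n≰n (down⇒≤n (suc n) down-j)
  ¬IsEdge-over-down {j = j} (inj₂ down-j) _ _ _ (inj₁ (_ , inj₂ up-j , _)) = up⇒¬down j up-j down-j

  ¬IsEdge-down-up : Down σ i → Up σ j → ¬ IsEdge σ i j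
  ¬IsEdge-down-up () _ (inj₁ (inj₁ refl , _))
  ¬IsEdge-down-up {i} down-i _ (inj₁ (inj₂ up-i , _)) = up⇒¬down i up-i down-i
  ¬IsEdge-down-up _ up-j (inj₂ (_ , inj₁ refl , _)) = 1+n≰n (up⇒≤n (suc n) up-j)
  ¬IsEdge-down-up {j = j} _ up-j (inj₂ (_ , inj₂ down-j , _)) = up⇒¬down j up-j down-j

  ¬IsEdge-up-down : Up σ i → Down σ j → ¬ IsEdge σ i j
  ¬IsEdge-up-down _ down-j (inj₁ (_ , inj₁ refl , _)) = 1+n≰n (down⇒≤n (suc n) down-j)
  ¬IsEdge-up-down {j = j} _ down-j (inj₁ (_ , inj₂ up-j , _)) = up⇒¬down j up-j down-j
  ¬IsEdge-up-down () _ (inj₂ (inj₁ refl , _))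
  ¬IsEdge-up-down {i} up-i _ (inj₂ (inj₂ down-i , _)) = up⇒¬down i up-i down-i

module Diagonals {n} (σ : Fin n → Bool) (x : List ℕ) {a} (1≤a : 1 ≤ a) (a<n : a < n) where

  onPath⇒H : ∀ k → 1 ≤ i → i ≤ n → OnPath σ x k i → H σ x k i ≡ true
  onPath⇒H _ () _ (inj₁ refl)
  onPath⇒H _ _ i≤n (inj₂ (inj₁ refl)) = contradiction i≤n 1+n≰n
  onPath⇒H _ _ _ (inj₂ (inj₂ h)) = h

  segment-skipping-suc⇔ : ∀ k →
    (∃[ i ] (suc a < i × IsSegment σ x k a i)) ⇔ (H σ x k a ≡ true × H σ x k (suc a) ≡ false)
  segment-skipping-suc⇔ k = mk⇔
    (λ (_ , a+1<i , _ , on-a , _ , gap) → onPath⇒H k 1≤a (<⇒≤ a<n) on-a , gap (suc a) ≤-refl a+1<i)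
    from
    where
    from : H σ x k a ≡ true × H σ x k (suc a) ≡ false → ∃[ i ] (suc a < i × IsSegment σ x k a i)
    from (h-a , h-a+1) with nearestAbove (H σ x k) (m<n⇒m<1+n a<n)
    ... | i , a<i , end , gap = i , ≤∧≢⇒< a<i a+1≢i , a<i , inj₂ (inj₂ h-a) , inj₂ end , gap
      where
      a+1≢i : suc a ≢ i
      a+1≢i refl = [ (λ a+1≡n+1 → <⇒≢ a<n (suc-injective a+1≡n+1))
                   , (λ h-i → contradiction (trans (sym h-i) h-a+1) λ ()) ]′ end

  segment-skipping-pred⇔ : ∀ k →
    (∃[ i ] (i < a × IsSegment σ x k i (suc a))) ⇔ (H σ x k a ≡ false × H σ x k (suc a) ≡ true)
  segment-skipping-pred⇔ k = mk⇔
    (λ (_ , i<a , _ , _ , on-a+1 , gap) → gap a i<a ≤-refl , onPath⇒H k (s≤s z≤n) a<n on-a+1)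
    from
    where
    from : H σ x k a ≡ false × H σ x k (suc a) ≡ true → ∃[ i ] (i < a × IsSegment σ x k i (suc a))
    from (h-a , h-a+1) with nearestBelow (H σ x k) a
    ... | i , i≤a , end , gap =
      i , i<a , m<n⇒m<1+n i<a , Sum.map₂ inj₂ end , inj₂ (inj₂ h-a+1) ,
      λ m i<m m<a+1 → gap m i<m (≤-pred m<a+1)
      where
      i<a : i < a
      i<a = ≤∧≢⇒< i≤a λ { refl → [ (λ a≡0 → <⇒≢ 1≤a (sym a≡0))
                                 , (λ h-i → contradiction (trans (sym h-i) h-a) λ ()) ]′ end }

  segment-consecutive⇔ : ∀ k →
    IsSegment σ x k a (suc a) ⇔ (H σ x k a ≡ true × H σ x k (suc a) ≡ true)
  segment-consecutive⇔ k = mk⇔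
    (λ (_ , on-a , on-a+1 , _) →
       onPath⇒H k 1≤a (<⇒≤ a<n) on-a , onPath⇒H k (s≤s z≤n) a<n on-a+1)
    (λ (h-a , h-a+1) → ≤-refl , inj₂ (inj₂ h-a) , inj₂ (inj₂ h-a+1) ,
       λ m a<m m<a+1 → contradiction (≤-pred m<a+1) (<⇒≱ a<m))

  diagonal-skipping-suc⇔ : (∀ i → suc a < i → ¬ IsEdge σ a i) →
    (∃[ i ] (suc a < i × η σ x a i))
      ⇔ (∃[ k ] (k ≤ n × H σ x k a ≡ true × H σ x k (suc a) ≡ false))
  diagonal-skipping-suc⇔ ¬edge = mk⇔
    (λ (i , a+1<i , _ , (k , k≤n , seg) , _) →
       k , k≤n , Equivalence.to (segment-skipping-suc⇔ k) (i , a+1<i , seg))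
    (λ (k , k≤n , h) → let (i , a+1<i , seg) = Equivalence.from (segment-skipping-suc⇔ k) h in
       i , a+1<i , proj₁ seg , (k , k≤n , seg) , ¬edge i a+1<i)

  diagonal-skipping-pred⇔ : (∀ i → i < a → ¬ IsEdge σ i (suc a)) →
    (∃[ i ] (i < a × η σ x i (suc a)))
      ⇔ (∃[ k ] (k ≤ n × H σ x k a ≡ false × H σ x k (suc a) ≡ true))
  diagonal-skipping-pred⇔ ¬edge = mk⇔
    (λ (i , i<a , _ , (k , k≤n , seg) , _) →
       k , k≤n , Equivalence.to (segment-skipping-pred⇔ k) (i , i<a , seg))
    (λ (k , k≤n , h) → let (i , i<a , seg) = Equivalence.from (segment-skipping-pred⇔ k) h in
       i , i<a , proj₁ seg , (k , k≤n , seg) , ¬edge i i<a)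

  diagonal-consecutive⇔ : ¬ IsEdge σ a (suc a) →
    η σ x a (suc a) ⇔ (∃[ k ] (k ≤ n × H σ x k a ≡ true × H σ x k (suc a) ≡ true))
  diagonal-consecutive⇔ ¬edge = mk⇔
    (λ (_ , (k , k≤n , seg) , _) → k , k≤n , Equivalence.to (segment-consecutive⇔ k) seg)
    (λ (k , k≤n , h) → ≤-refl , (k , k≤n , Equivalence.from (segment-consecutive⇔ k) h) , ¬edge)

module Descents {n} (σ : Fin n → Bool) {x : List ℕ} (x↭ : x ↭ range n)
                {a} (1≤a : 1 ≤ a) (a<n : a < n) where

  open Diagonals σ x 1≤a a<n

  private
    unique : Unique x
    unique = ↭range⇒unique x↭

    length≤n : length x ≤ n
    length≤n = ≤-reflexive (↭range⇒length x↭)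

    a∈x : a ∈ x
    a∈x = ∈-↭range x↭ 1≤a (<⇒≤ a<n)

    a+1∈x : suc a ∈ x
    a+1∈x = ∈-↭range x↭ (s≤s z≤n) a<n

    swap⇔ : ∀ {B C : Set} → (B × C) ⇔ (C × B)
    swap⇔ = ↔⇒⇔ (×-comm _ _)

  -- LeftDescent x a unfolds to Precedes x (suc a) a.
  descent⇔∃ : (∀ {k} → P k ⇔ (suc a ∈ take k x × a ∉ take k x)) →
    LeftDescent x a ⇔ (∃[ k ] (k ≤ n × P k))
  descent⇔∃ P⇔ = ∃≤-cong (⇔-sym P⇔) ⇔-∘ precedes⇔prefix unique a∈x length≤n

  descent⇔¬∃ : (∀ {k} → P k ⇔ (a ∈ take k x × suc a ∉ take k x)) →
    LeftDescent x a ⇔ (¬ (∃[ k ] (k ≤ n × P k)))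
  descent⇔¬∃ P⇔ =
    ¬-cong-⇔ (∃≤-cong (⇔-sym P⇔) ⇔-∘ precedes⇔prefix unique a+1∈x length≤n)
      ⇔-∘ precedes⇔¬precedes unique 1+n≢n a+1∈x a∈x

  down-down : Down σ a → Down σ (suc a) →
      (LeftDescent x a ⇔ (∃[ i ] (suc a < i × η σ x a i)))
    × (LeftDescent x a ⇔ (¬ (∃[ i ] (i < a × η σ x i (suc a)))))
  down-down down-a down-a+1 =
      ⇔-sym (diagonal-skipping-suc⇔ ¬edge-from-a)
        ⇔-∘ descent⇔∃ (swap⇔ ⇔-∘ (down⇒H≡true⇔∉ σ a down-a ×-⇔ down⇒H≡false⇔∈ σ (suc a) down-a+1))
    , ¬-cong-⇔ (⇔-sym (diagonal-skipping-pred⇔ ¬edge-to-a+1))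
        ⇔-∘ descent⇔¬∃ (down⇒H≡false⇔∈ σ a down-a ×-⇔ down⇒H≡true⇔∉ σ (suc a) down-a+1)
    where
    ¬edge-from-a : ∀ i → suc a < i → ¬ IsEdge σ a i
    ¬edge-from-a _ = ¬IsEdge-over-down σ (inj₁ down-a) down-a+1 ≤-refl
    ¬edge-to-a+1 : ∀ i → i < a → ¬ IsEdge σ i (suc a)
    ¬edge-to-a+1 _ i<a = ¬IsEdge-over-down σ (inj₂ down-a+1) down-a i<a ≤-refl

  down-up : Down σ a → Up σ (suc a) → LeftDescent x a ⇔ η σ x a (suc a)
  down-up down-a up-a+1 =
    ⇔-sym (diagonal-consecutive⇔ (¬IsEdge-down-up σ down-a up-a+1))
      ⇔-∘ descent⇔∃ (swap⇔ ⇔-∘ (down⇒H≡true⇔∉ σ a down-a ×-⇔ up⇒H≡true⇔∈ σ (suc a) up-a+1))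

  up-up : Up σ a → Up σ (suc a) →
      (LeftDescent x a ⇔ (¬ (∃[ i ] (suc a < i × η σ x a i))))
    × (LeftDescent x a ⇔ (∃[ i ] (i < a × η σ x i (suc a))))
  up-up up-a up-a+1 =
      ¬-cong-⇔ (⇔-sym (diagonal-skipping-suc⇔ ¬edge-from-a))
        ⇔-∘ descent⇔¬∃ (up⇒H≡true⇔∈ σ a up-a ×-⇔ up⇒H≡false⇔∉ σ (suc a) up-a+1)
    , ⇔-sym (diagonal-skipping-pred⇔ ¬edge-to-a+1)
        ⇔-∘ descent⇔∃ (swap⇔ ⇔-∘ (up⇒H≡false⇔∉ σ a up-a ×-⇔ up⇒H≡true⇔∈ σ (suc a) up-a+1))
    where
    ¬edge-from-a : ∀ i → suc a < i → ¬ IsEdge σ a i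
    ¬edge-from-a _ = ¬IsEdge-over-up σ (inj₁ up-a) up-a+1 ≤-refl
    ¬edge-to-a+1 : ∀ i → i < a → ¬ IsEdge σ i (suc a)
    ¬edge-to-a+1 _ i<a = ¬IsEdge-over-up σ (inj₂ up-a+1) up-a i<a ≤-refl

  up-down : Up σ a → Down σ (suc a) → LeftDescent x a ⇔ (¬ η σ x a (suc a))
  up-down up-a down-a+1 =
    ¬-cong-⇔ (⇔-sym (diagonal-consecutive⇔ (¬IsEdge-up-down σ up-a down-a+1)))
      ⇔-∘ descent⇔¬∃ (up⇒H≡true⇔∈ σ a up-a ×-⇔ down⇒H≡true⇔∉ σ (suc a) down-a+1)

proposition6p6 : (n : ℕ) (σ : Fin n → Bool) (x : List ℕ) → x ↭ range n →
    (a : ℕ) → 1 ≤ a → a < n →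
      (Down σ a → Down σ (suc a) →
        (LeftDescent x a ⇔ (∃[ i ] (suc a < i × η σ x a i)))
        × (LeftDescent x a ⇔ (¬ (∃[ i ] (i < a × η σ x i (suc a))))))
      × (Down σ a → Up σ (suc a) →
        (LeftDescent x a ⇔ η σ x a (suc a)))
      × (Up σ a → Up σ (suc a) →
        (LeftDescent x a ⇔ (¬ (∃[ i ] (suc a < i × η σ x a i))))
        × (LeftDescent x a ⇔ (∃[ i ] (i < a × η σ x i (suc a)))))
      × (Up σ a → Down σ (suc a) →
        (LeftDescent x a ⇔ (¬ η σ x a (suc a))))
proposition6p6 n σ x x↭ a 1≤a a<n = down-down , down-up , up-up , up-down
  where open Descents σ x↭ 1≤a a<n
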